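{- Let $r\ge\max(2,D,2\|\mathcal{A}\|+1)$ be an integer and $z\in\mathcal{A}$. Let $C$ be the subgraph of $\Gamma$ induced by $V(B_r)\cup V(B_r+z)$, let $\lambda$ be a subgraph of $\Gamma$ and $\phi:C\to\lambda$ a graph isomorphism. Then the restrictions of $\phi$ to $B_r$ and to $B_r+z$ have equal orientations, i.e. $\phi(x)-\phi(0)=\phi(z+x)-\phi(z)$ for every $x\in\mathcal{A}'$.
   Context: Let $G$ be a free abelian group of finite rank $k\ge1$, identified with $\mathbb{Z}^k$, and $\mathcal{A}\subset G$ a finite generating set with $\mathcal{A}=-\mathcal{A}$, $0\notin\mathcal{A}$. $\Gamma=\mathrm{Cay}(G,\mathcal{A})$ has vertex set $G$ and edges $\{x,x+a\}$, $a\in\mathcal{A}$. $\rho(x)$ is the length of a shortest path in $\Gamma$ from $0$ to $x$, $\omega(x)$ the number of such shortest paths. $B_r$ is the subgraph of $\Gamma$ induced by $\{x:\rho(x)\le r\}$, $B_r+z$ its translate. An element $x\in\mathcal{A}$ is primary if $\rho(tx)=t$ and $\omega(tx)=1$ for all integers $t\ge0$, otherwise secondary; $\mathcal{A}'$ is the set of primary elements. $D$ is a fixed positive integer such that every secondary $x\in\mathcal{A}$ satisfies $\rho(Dx)\ne D$ or $\omega(Dx)\ne 1$. $\|x\|$ is the $\ell_\infty$-norm of $x\in\mathbb{Z}^k$ and $\|\mathcal{A}\|=\max_{x\in\mathcal{A}}\|x\|$. The orientation of an isomorphism $\psi$ from $B_r+w$ onto a subgraph of $\Gamma$ is the map $\mathcal{A}'\to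 G$, $x\mapsto\psi(x+w)-\psi(w)$. -}

module Defs where

open import Data.Nat as ℕ using (ℕ; _⊔_; _<_; _≤_)
open import Data.Integer as ℤ using (ℤ; +_; ∣_∣)
open import Data.Vec as Vec using (Vec; zipWith; replicate)
open import Data.Vec.Relation.Unary.All as VAll using ()
open import Data.List as List using (List)
open import Data.List.Membership.Propositional using (_∈_)
open import Data.List.Relation.Unary.Unique.Propositional using (Unique)
open import Data.Product using (Σ; ∃; _×_; proj₁)
open import Data.Sum using (_⊎_)
open import Relation.Nullary using (¬_)
open import Relation.Binary.PropositionalEquality using (_≡_)

G : ℕ → Set
G k = Vec ℤ k

module _ {k : ℕ} where

  infixl 6 _⊕_ _⊖_

  𝟘 : G k
  𝟘 = replicate k (+ 0)

  _⊕_ : G k → G k → G k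
  _⊕_ = zipWith ℤ._+_

  ⊝_ : G k → G k
  ⊝_ = Vec.map (λ c → ℤ.- c)

  _⊖_ : G k → G k → G k
  x ⊖ y = x ⊕ (⊝ y)

  _·_ : ℕ → G k → G k
  t · x = Vec.map (λ c → (+ t) ℤ.* c) x

  Σv : {n : ℕ} → Vec (G k) n → G k
  Σv = Vec.foldr′ _⊕_ 𝟘

  ‖_‖ : G k → ℕ
  ‖ x ‖ = List.foldr (λ c m → ∣ c ∣ ⊔ m) 0 (Vec.toList x)

  -- The finite generating set 𝒜 is given as a duplicate-free list.
  ‖_‖ₐ : List (G k) → ℕ
  ‖ A ‖ₐ = List.foldr (λ a m → ‖ a ‖ ⊔ m) 0 A

  module _ (A : List (G k)) where

    -- A walk of length n in Γ = Cay(G,𝒜) from 0 to x, encoded by its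
    -- sequence of steps (a₁,…,aₙ) ∈ 𝒜ⁿ with a₁+…+aₙ = x.  In a Cayley
    -- graph the step sequence determines the vertex sequence and vice versa.
    Walk : G k → ℕ → Set
    Walk x n = Σ (Vec (G k) n) λ ws → VAll.All (λ a → a ∈ A) ws × Σv ws ≡ x

    ρ≡ : G k → ℕ → Set
    ρ≡ x n = Walk x n × (∀ m → m < n → ¬ Walk x m)

    -- ρ(x) = n and ω(x) = 1 : n is the distance and there is exactly one
    -- walk of length n (shortest walks are exactly the shortest paths).
    ρ≡∧ω≡1 : G k → ℕ → Set
    ρ≡∧ω≡1 x n = ρ≡ x n × (∀ (w w' : Walk x n) → proj₁ w ≡ proj₁ w')

    Primary : G k → Set
    Primary x = x ∈ A × (∀ t → ρ≡∧ω≡1 (t · x) t)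

    Secondary : G k → Set
    Secondary x = x ∈ A × ¬ Primary x

    Symmetric : Set
    Symmetric = ∀ a → a ∈ A → (⊝ a) ∈ A

    Generates : Set
    Generates = ∀ x → ∃ λ n → Walk x n

    GoodD : ℕ → Set
    GoodD D = 1 ≤ D × (∀ x → Secondary x → ¬ ρ≡∧ω≡1 (D · x) D)

    Adj : G k → G k → Set
    Adj u v = Σ (G k) λ a → a ∈ A × v ≡ u ⊕ a

    InBall : ℕ → G k → Set
    InBall r x = Σ ℕ λ n → ρ≡ x n × n ≤ r

    InC : ℕ → G k → G k → Set
    InC r z x = InBall r x ⊎ InBall r (x ⊖ z)

    record Subgraph : Set₁ where
      field
        V : G k → Set
        E : G k → G k → Set
        E-sym : ∀ u v → E u v → E v u
        E⊆Adj : ∀ u v → E u v → Adj u v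
        E⊆V : ∀ u v → E u v → V u × V v

    -- φ : C → λ is a graph isomorphism (C induced subgraph of Γ on InC r z);
    -- φ is given as a function on G whose values off V(C) are irrelevant.
    IsIso : ℕ → G k → (λg : Subgraph) → (G k → G k) → Set
    IsIso r z λg φ =
        (∀ x → InC r z x → Subgraph.V λg (φ x))
      × (∀ x y → InC r z x → InC r z y → φ x ≡ φ y → x ≡ y)
      × (∀ y → Subgraph.V λg y → Σ (G k) λ x → InC r z x × φ x ≡ y)
      × (∀ x y → InC r z x → InC r z y → (Adj x y → Subgraph.E λg (φ x) (φ y))
                                        × (Subgraph.E λg (φ x) (φ y) → Adj x y))

{-# OPTIONS --safe #-}
-- Where u and all its neighbours lie in C, a ↦ φ(u + a) − φ(u) is an injection of the finite
-- set 𝒜 into itself, hence onto 𝒜. So if the two x-steps u → u + x → u + 2x are sent to s₁, s₂,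
-- some path u → u + w → u + w + w' is sent to s₂ followed by s₁ and ends at φ(u + 2x) as well;
-- injectivity and uniqueness of the geodesic to 2x (x is primary) give w = x and s₁ = s₂.
-- Hence φ maps {ix : i ≤ r} and {z + ix : i ≤ r} onto arithmetic progressions with steps s and
-- s'. At i = 0 and i = n = 2‖𝒜‖ + 1 the two progressions are joined by edges, so n(s − s') is a
-- difference of two elements of 𝒜, of norm at most 2‖𝒜‖ < n; therefore s = s'.
module Submission where

open import Defs
open import Algebra.Bundles using (AbelianGroup)
open import Algebra.Structures using (IsAbelianGroup)
import Algebra.Properties.AbelianGroup as AbelianGroupProperties
import Algebra.Properties.CommutativeSemigroup as CommutativeSemigroupProperties
open import Data.Fin using (Fin; zero; suc)
open import Data.Fin.Properties using (injective⇒≤)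
open import Data.Integer as ℤ using (ℤ; +_; ∣_∣)
import Data.Integer.Properties as ℤ
open import Data.Integer.Tactic.RingSolver using (solve-∀)
open import Data.List as List using (List; []; _∷_; length)
open import Data.List.Membership.Propositional using (_∈_; find; lose)
open import Data.List.Membership.Propositional.Properties using (∈-lookup)
import Data.List.Relation.Unary.All as All
open import Data.List.Relation.Unary.Any as Any using (here; there; any?)
open import Data.List.Relation.Unary.Any.Properties using (lookup-index)
open import Data.List.Relation.Unary.AllPairs using (_∷_)
open import Data.List.Relation.Unary.Unique.Propositional using (Unique)
open import Data.Nat as ℕ using (ℕ; zero; suc; _≤_; _<_; _+_; _*_; z≤n)
import Data.Nat.Properties as ℕ
open import Data.Nat.Induction using (<-rec)
open import Data.Product using (∃; _×_; _,_; proj₁; proj₂)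
open import Data.Sum using (inj₁; inj₂)
open import Data.Vec as Vec using (Vec; []; _∷_)
open import Data.Vec.Properties
  using (≡-dec; ∷-injectiveˡ; ∷-injectiveʳ; zipWith-assoc; zipWith-comm; zipWith-identityˡ; zipWith-identityʳ; zipWith-inverseˡ; zipWith-inverseʳ)
open import Data.Vec.Relation.Unary.All as VAll using ([]; _∷_)
open import Function.Definitions using (Injective)
open import Level using (0ℓ)
open import Relation.Binary.Definitions using (DecidableEquality)
open import Relation.Binary.PropositionalEquality
open import Relation.Nullary using (¬_; Dec; yes; no; contradiction)
open import Relation.Unary using (Decidable)

⊕-isAbelianGroup : ∀ {k} → IsAbelianGroup _≡_ (_⊕_ {k}) 𝟘 ⊝_
⊕-isAbelianGroup = record
  { isGroup = record
    { isMonoid = record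
      { isSemigroup = record
        { isMagma = record { isEquivalence = isEquivalence ; ∙-cong = cong₂ _⊕_ }
        ; assoc = zipWith-assoc ℤ.+-assoc
        }
      ; identity = zipWith-identityˡ ℤ.+-identityˡ , zipWith-identityʳ ℤ.+-identityʳ
      }
    ; inverse = zipWith-inverseˡ ℤ.+-inverseˡ , zipWith-inverseʳ ℤ.+-inverseʳ
    ; ⁻¹-cong = cong ⊝_
    }
  ; comm = zipWith-comm ℤ.+-comm
  }

⊕-abelianGroup : ℕ → AbelianGroup 0ℓ 0ℓ
⊕-abelianGroup k = record { isAbelianGroup = ⊕-isAbelianGroup {k} }

·-zeroˡ : ∀ {k} (x : G k) → 0 · x ≡ 𝟘
·-zeroˡ []       = refl
·-zeroˡ (_ ∷ xs) = cong (+ 0 ∷_) (·-zeroˡ xs)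

·-suc : ∀ {k} n (x : G k) → suc n · x ≡ x ⊕ n · x
·-suc n []       = refl
·-suc n (c ∷ cs) = cong₂ _∷_ (ℤ.suc-* (+ n) c) (·-suc n cs)

module _ {k : ℕ} where

  open AbelianGroup (⊕-abelianGroup k) public
    using () renaming (assoc to ⊕-assoc; identityˡ to ⊕-identityˡ; identityʳ to ⊕-identityʳ; inverseʳ to ⊕-inverseʳ)
  open AbelianGroupProperties (⊕-abelianGroup k) public
    using () renaming (∙-cancelˡ to ⊕-cancelˡ)
  open CommutativeSemigroupProperties (AbelianGroup.commutativeSemigroup (⊕-abelianGroup k)) public
    using () renaming (xy∙z≈xz∙y to [x⊕y]⊕z≡[x⊕z]⊕y)

  open AbelianGroup (⊕-abelianGroup k) using (comm; commutativeSemigroup)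
  open AbelianGroupProperties (⊕-abelianGroup k) using (∙-cancelʳ; //-rightDividesˡ; //-rightDividesʳ; ε⁻¹≈ε)
  open CommutativeSemigroupProperties commutativeSemigroup using (xy∙z≈y∙xz)

  ⊖-cancelʳ : (x y z : G k) → y ⊖ x ≡ z ⊖ x → y ≡ z
  ⊖-cancelʳ x = ∙-cancelʳ (⊝ x)

  x⊕[y⊖x]≡y : (x y : G k) → x ⊕ (y ⊖ x) ≡ y
  x⊕[y⊖x]≡y x y = trans (comm x (y ⊖ x)) (//-rightDividesˡ x y)

  [x⊕y]⊖x≡y : (x y : G k) → (x ⊕ y) ⊖ x ≡ y
  [x⊕y]⊖x≡y x y = trans (cong (_⊖ x) (comm x y)) (//-rightDividesʳ x y)

  x⊖𝟘≡x : (x : G k) → x ⊖ 𝟘 ≡ x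
  x⊖𝟘≡x x = trans (cong (x ⊕_) ε⁻¹≈ε) (⊕-identityʳ x)

  [x⊕y]⊖z≡y⊕[x⊖z] : (x y z : G k) → (x ⊕ y) ⊖ z ≡ y ⊕ (x ⊖ z)
  [x⊕y]⊖z≡y⊕[x⊖z] x y z = xy∙z≈y∙xz x y (⊝ z)

  y⊕0·x≡y : (y x : G k) → y ⊕ 0 · x ≡ y
  y⊕0·x≡y y x = trans (cong (y ⊕_) (·-zeroˡ x)) (⊕-identityʳ y)

  y⊕[1+n]·x≡[y⊕n·x]⊕x : ∀ (y : G k) n x → y ⊕ suc n · x ≡ (y ⊕ n · x) ⊕ x
  y⊕[1+n]·x≡[y⊕n·x]⊕x y n x = begin
    y ⊕ suc n · x      ≡⟨ cong (y ⊕_) (·-suc n x) ⟩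
    y ⊕ (x ⊕ n · x)    ≡⟨ ⊕-assoc y x (n · x) ⟨
    (y ⊕ x) ⊕ n · x    ≡⟨ [x⊕y]⊕z≡[x⊕z]⊕y y x (n · x) ⟩
    (y ⊕ n · x) ⊕ x    ∎
    where open ≡-Reasoning

module _ {X : Set} where

  lookup-injective : ∀ {xs : List X} → Unique xs → Injective _≡_ _≡_ (List.lookup xs)
  lookup-injective {_ ∷ _} (_   ∷ _) {zero}  {zero}  _ = refl
  lookup-injective {_ ∷ _} (x∉ ∷ _) {zero}  {suc j} e = contradiction e (All.lookup x∉ (∈-lookup j))
  lookup-injective {_ ∷ _} (x∉ ∷ _) {suc i} {zero}  e = contradiction (sym e) (All.lookup x∉ (∈-lookup i))
  lookup-injective {_ ∷ _} (_   ∷ u) {suc i} {suc j} e = cong suc (lookup-injective u e)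

  -- If y were missed, y and the images of xs would occupy length xs + 1 distinct positions of xs.
  injectiveOn⇒surjectiveOn : DecidableEquality X → ∀ {xs} → Unique xs → (f : X → X)
    → (∀ {x} → x ∈ xs → f x ∈ xs)
    → (∀ {x y} → x ∈ xs → y ∈ xs → f x ≡ f y → x ≡ y)
    → ∀ {y} → y ∈ xs → ∃ λ x → x ∈ xs × f x ≡ y
  injectiveOn⇒surjectiveOn _≟_ {xs} xs-unique f f-into f-injective {y} y∈xs
    with any? (λ x → f x ≟ y) xs
  ... | yes hit = find hit
  ... | no miss = contradiction (injective⇒≤ position-injective) (ℕ.n≮n (length xs))
    where
    point : Fin (suc (length xs)) → X
    point zero    = y
    point (suc i) = f (List.lookup xs i)

    position : Fin (suc (length xs)) → Fin (length xs)
    position zero    = Any.index y∈xs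
    position (suc i) = Any.index (f-into (∈-lookup i))

    lookup-position : ∀ i → List.lookup xs (position i) ≡ point i
    lookup-position zero    = sym (lookup-index y∈xs)
    lookup-position (suc i) = sym (lookup-index (f-into (∈-lookup i)))

    point-injective : Injective _≡_ _≡_ point
    point-injective {zero}  {zero}  _ = refl
    point-injective {zero}  {suc j} e = contradiction (lose (∈-lookup j) (sym e)) miss
    point-injective {suc i} {zero}  e = contradiction (lose (∈-lookup i) e) miss
    point-injective {suc i} {suc j} e =
      cong suc (lookup-injective xs-unique (f-injective (∈-lookup i) (∈-lookup j) e))

    position-injective : Injective _≡_ _≡_ position
    position-injective {i} {j} e =
      point-injective (trans (sym (lookup-position i)) (trans (cong (List.lookup xs) e) (lookup-position j)))

module _ {P : ℕ → Set} (P? : Decidable P) where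

  minimal : ∀ m → P m → ∃ λ n → n ≤ m × P n × (∀ j → j < n → ¬ P j)
  minimal = <-rec _ search
    where
    search : ∀ m → (∀ {n} → n < m → P n → ∃ λ l → l ≤ n × P l × (∀ j → j < l → ¬ P j))
           → P m → ∃ λ n → n ≤ m × P n × (∀ j → j < n → ¬ P j)
    search m smaller pm with ℕ.anyUpTo? P? m
    ... | yes (n , n<m , pn) =
      let l , l≤n , pl , below = smaller n<m pn in l , ℕ.≤-trans l≤n (ℕ.<⇒≤ n<m) , pl , below
    ... | no none = m , ℕ.≤-refl , pm , λ j j<m pj → none (j , j<m , pj)

+n*i+j≡+n*k+l⇒i≡k : ∀ {n} (i j k l : ℤ) → ∣ j ∣ + ∣ l ∣ < n
  → + n ℤ.* i ℤ.+ j ≡ + n ℤ.* k ℤ.+ l → i ≡ k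
+n*i+j≡+n*k+l⇒i≡k {n} i j k l bound eq =
  ℤ.i-j≡0⇒i≡j i k (ℤ.∣i∣≡0⇒i≡0 (ℕ.n<1⇒n≡0 (ℕ.*-cancelˡ-< n _ 1 n∣i-k∣<n)))
  where
  multiple : + n ℤ.* (i ℤ.- k) ≡ l ℤ.- j
  multiple = begin
    + n ℤ.* (i ℤ.- k)                                   ≡⟨ lhs (+ n) i j k ⟩
    (+ n ℤ.* i ℤ.+ j) ℤ.- (+ n ℤ.* k ℤ.+ j)             ≡⟨ cong (ℤ._- (+ n ℤ.* k ℤ.+ j)) eq ⟩
    (+ n ℤ.* k ℤ.+ l) ℤ.- (+ n ℤ.* k ℤ.+ j)             ≡⟨ rhs (+ n) k j l ⟩
    l ℤ.- j                                             ∎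
    where
    open ≡-Reasoning
    lhs : ∀ m i j k → m ℤ.* (i ℤ.- k) ≡ (m ℤ.* i ℤ.+ j) ℤ.- (m ℤ.* k ℤ.+ j)
    lhs = solve-∀
    rhs : ∀ m k j l → (m ℤ.* k ℤ.+ l) ℤ.- (m ℤ.* k ℤ.+ j) ≡ l ℤ.- j
    rhs = solve-∀

  n∣i-k∣<n : n * ∣ i ℤ.- k ∣ < n * 1
  n∣i-k∣<n = begin-strict
    n * ∣ i ℤ.- k ∣          ≡⟨ ℤ.abs-* (+ n) (i ℤ.- k) ⟨
    ∣ + n ℤ.* (i ℤ.- k) ∣    ≡⟨ cong ∣_∣ multiple ⟩
    ∣ l ℤ.- j ∣              ≤⟨ ℤ.∣i-j∣≤∣i∣+∣j∣ l j ⟩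
    ∣ l ∣ + ∣ j ∣            ≡⟨ ℕ.+-comm ∣ l ∣ ∣ j ∣ ⟩
    ∣ j ∣ + ∣ l ∣            <⟨ bound ⟩
    n                        ≡⟨ ℕ.*-identityʳ n ⟨
    n * 1                    ∎
    where open ℕ.≤-Reasoning

n·a⊕p≡n·b⊕q⇒a≡b : ∀ {k n} (a p b q : G k) → ‖ p ‖ + ‖ q ‖ < n → n · a ⊕ p ≡ n · b ⊕ q → a ≡ b
n·a⊕p≡n·b⊕q⇒a≡b []       []       []       []       _     _  = refl
n·a⊕p≡n·b⊕q⇒a≡b (a ∷ as) (p ∷ ps) (b ∷ bs) (q ∷ qs) bound eq = cong₂ _∷_
  (+n*i+j≡+n*k+l⇒i≡k a p b q (ℕ.≤-<-trans (ℕ.+-mono-≤ (ℕ.m≤m⊔n ∣ p ∣ ‖ ps ‖) (ℕ.m≤m⊔n ∣ q ∣ ‖ qs ‖)) bound)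
    (∷-injectiveˡ eq))
  (n·a⊕p≡n·b⊕q⇒a≡b as ps bs qs (ℕ.≤-<-trans (ℕ.+-mono-≤ (ℕ.m≤n⊔m ∣ p ∣ ‖ ps ‖) (ℕ.m≤n⊔m ∣ q ∣ ‖ qs ‖)) bound)
    (∷-injectiveʳ eq))

module _ {k : ℕ} (A : List (G k)) where

  ∃-steps? : ∀ n {Q : Vec (G k) n → Set} → (∀ ws → Dec (Q ws))
    → Dec (∃ λ ws → VAll.All (_∈ A) ws × Q ws)
  ∃-steps? zero    Q? with Q? []
  ... | yes q = yes ([] , [] , q)
  ... | no ¬q = no λ { ([] , [] , q) → ¬q q }
  ∃-steps? (suc n) Q? with any? (λ a → ∃-steps? n (λ ws → Q? (a ∷ ws))) A
  ... | yes found = let a , a∈A , ws , ws⊆A , q = find found in yes (a ∷ ws , a∈A ∷ ws⊆A , q)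
  ... | no none   = no λ { (a ∷ ws , a∈A ∷ ws⊆A , q) → none (lose a∈A (ws , ws⊆A , q)) }

  walk? : ∀ x n → Dec (Walk A x n)
  walk? x n = ∃-steps? n (λ ws → ≡-dec ℤ._≟_ (Σv ws) x)

  walk⇒inBall : ∀ {r x m} → Walk A x m → m ≤ r → InBall A r x
  walk⇒inBall {x = x} {m} w m≤r =
    let n , n≤m , wₙ , shorter = minimal (λ n → walk? x n) m w in
    n , (wₙ , shorter) , ℕ.≤-trans n≤m m≤r

  walk-⊖ : ∀ {a u c m} → a ∈ A → Walk A (u ⊖ c) m → Walk A ((u ⊕ a) ⊖ c) (suc m)
  walk-⊖ {a} {u} {c} a∈A (ws , ws⊆A , eq) =
    a ∷ ws , a∈A ∷ ws⊆A , trans (cong (a ⊕_) eq) (sym ([x⊕y]⊖z≡y⊕[x⊖z] u a c))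

  walk-· : ∀ {x} n → x ∈ A → Walk A (n · x) n
  walk-· {x} zero    _   = [] , [] , sym (·-zeroˡ x)
  walk-· {x} (suc n) x∈A =
    let ws , ws⊆A , eq = walk-· n x∈A in x ∷ ws , x∈A ∷ ws⊆A , trans (cong (x ⊕_) eq) (sym (·-suc n x))

  ‖‖-∈ : ∀ {a} → a ∈ A → ‖ a ‖ ≤ ‖ A ‖ₐ
  ‖‖-∈ = go A
    where
    go : ∀ B {a} → a ∈ B → ‖ a ‖ ≤ ‖ B ‖ₐ
    go (b ∷ B) (here refl) = ℕ.m≤m⊔n ‖ b ‖ ‖ B ‖ₐ
    go (b ∷ B) (there a∈B) = ℕ.≤-trans (go B a∈B) (ℕ.m≤n⊔m ‖ b ‖ ‖ B ‖ₐ)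

  primary⇒x⊕x-unique : ∀ {x w w'} → Primary A x → w ∈ A → w' ∈ A → w ⊕ w' ≡ x ⊕ x → w ≡ x
  primary⇒x⊕x-unique {x} {w} {w'} (x∈A , geodesic) w∈A w'∈A eq =
    ∷-injectiveˡ (proj₂ (geodesic 2) (w ∷ w' ∷ [] , w∈A ∷ w'∈A ∷ [] , sum) (x ∷ x ∷ [] , x∈A ∷ x∈A ∷ [] , sum-x))
    where
    sum-x : x ⊕ (x ⊕ 𝟘) ≡ 2 · x
    sum-x = proj₂ (proj₂ (walk-· 2 x∈A))
    sum : w ⊕ (w' ⊕ 𝟘) ≡ 2 · x
    sum = trans (cong (w ⊕_) (⊕-identityʳ w')) (trans eq (trans (cong (x ⊕_) (sym (⊕-identityʳ x))) sum-x))

module Neighbourhoods {k : ℕ} (A : List (G k)) (S : G k → Set) where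

  Interior : G k → Set
  Interior u = S u × (∀ {a} → a ∈ A → S (u ⊕ a))

  Covers : G k → ℕ → Set
  Covers c r = ∀ {u m} → Walk A (u ⊖ c) m → m ≤ r → S u

  covers-centre : ∀ {c r} → Covers c r → S c
  covers-centre {c} cov = cov ([] , [] , sym (⊕-inverseʳ c)) z≤n

  covered⇒interior : ∀ {c r u m} → Covers c r → Walk A (u ⊖ c) m → m < r → Interior u
  covered⇒interior cov w m<r = cov w (ℕ.<⇒≤ m<r) , λ a∈A → cov (walk-⊖ A a∈A w) m<r

module Rigidity {k : ℕ} {A : List (G k)} (A-unique : Unique A) {S : G k → Set} {φ : G k → G k}
  (φ-injective : ∀ {u v} → S u → S v → φ u ≡ φ v → u ≡ v)
  (φ-edge : ∀ {u a} → a ∈ A → S u → S (u ⊕ a) → φ (u ⊕ a) ⊖ φ u ∈ A)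
  where

  open Neighbourhoods A S

  δ : G k → G k → G k
  δ u a = φ (u ⊕ a) ⊖ φ u

  φ-⊕ : ∀ u a → φ (u ⊕ a) ≡ φ u ⊕ δ u a
  φ-⊕ u a = sym (x⊕[y⊖x]≡y (φ u) (φ (u ⊕ a)))

  δ-surjective : ∀ {u b} → Interior u → b ∈ A → ∃ λ w → w ∈ A × δ u w ≡ b
  δ-surjective {u} (Su , S[u⊕A]) =
    injectiveOn⇒surjectiveOn (≡-dec ℤ._≟_) A-unique (δ u)
      (λ a∈A → φ-edge a∈A Su (S[u⊕A] a∈A))
      (λ {a} {b} a∈A b∈A eq →
        ⊕-cancelˡ u a b (φ-injective (S[u⊕A] a∈A) (S[u⊕A] b∈A) (⊖-cancelʳ (φ u) _ _ eq)))

  detour-is-straight : ∀ {x u w w'} → Primary A x → (∀ {v} → v ∈ A → Interior (u ⊕ v))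
    → w ∈ A → w' ∈ A → δ u w ≡ δ (u ⊕ x) x → δ (u ⊕ w) w' ≡ δ u x → w ≡ x
  detour-is-straight {x} {u} {w} {w'} px@(x∈A , _) int-u⊕ w∈A w'∈A w-step w'-step =
    primary⇒x⊕x-unique A px w∈A w'∈A (⊕-cancelˡ u (w ⊕ w') (x ⊕ x) (begin
      u ⊕ (w ⊕ w')                      ≡⟨ ⊕-assoc u w w' ⟨
      (u ⊕ w) ⊕ w'                      ≡⟨ φ-injective (proj₂ (int-u⊕ w∈A) w'∈A) (proj₂ (int-u⊕ x∈A) x∈A) same-image ⟩
      (u ⊕ x) ⊕ x                       ≡⟨ ⊕-assoc u x x ⟩
      u ⊕ (x ⊕ x)                       ∎))
    where
    open ≡-Reasoning
    same-image : φ ((u ⊕ w) ⊕ w') ≡ φ ((u ⊕ x) ⊕ x)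
    same-image = begin
      φ ((u ⊕ w) ⊕ w')                  ≡⟨ φ-⊕ (u ⊕ w) w' ⟩
      φ (u ⊕ w) ⊕ δ (u ⊕ w) w'          ≡⟨ cong₂ _⊕_ (φ-⊕ u w) w'-step ⟩
      (φ u ⊕ δ u w) ⊕ δ u x             ≡⟨ cong (λ t → (φ u ⊕ t) ⊕ δ u x) w-step ⟩
      (φ u ⊕ δ (u ⊕ x) x) ⊕ δ u x       ≡⟨ [x⊕y]⊕z≡[x⊕z]⊕y (φ u) (δ (u ⊕ x) x) (δ u x) ⟩
      (φ u ⊕ δ u x) ⊕ δ (u ⊕ x) x       ≡⟨ cong (_⊕ δ (u ⊕ x) x) (φ-⊕ u x) ⟨
      φ (u ⊕ x) ⊕ δ (u ⊕ x) x           ≡⟨ φ-⊕ (u ⊕ x) x ⟨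
      φ ((u ⊕ x) ⊕ x)                   ∎

  δ-step-invariant : ∀ {x u} → Primary A x → Interior u → (∀ {w} → w ∈ A → Interior (u ⊕ w))
    → δ (u ⊕ x) x ≡ δ u x
  δ-step-invariant {x} {u} px@(x∈A , _) int-u@(Su , S[u⊕A]) int-u⊕ =
    let w , w∈A , w-step = δ-surjective int-u s₂∈A
        w' , w'∈A , w'-step = δ-surjective (int-u⊕ w∈A) s₁∈A
    in trans (sym w-step) (cong (δ u) (detour-is-straight px int-u⊕ w∈A w'∈A w-step w'-step))
    where
    s₁∈A : δ u x ∈ A
    s₁∈A = φ-edge x∈A Su (S[u⊕A] x∈A)
    s₂∈A : δ (u ⊕ x) x ∈ A
    s₂∈A = φ-edge x∈A (proj₁ (int-u⊕ x∈A)) (proj₂ (int-u⊕ x∈A) x∈A)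

  module Line {x c r} (px : Primary A x) (cov : Covers c r) where

    walk-line : ∀ i → Walk A ((c ⊕ i · x) ⊖ c) i
    walk-line i = subst (λ y → Walk A y i) (sym ([x⊕y]⊖x≡y c (i · x))) (walk-· A i (proj₁ px))

    on-line : ∀ {i} → i ≤ r → S (c ⊕ i · x)
    on-line {i} = cov (walk-line i)

    δ-line : ∀ i → suc i ≤ r → δ (c ⊕ i · x) x ≡ δ c x
    δ-line zero    _     = cong (λ v → δ v x) (y⊕0·x≡y c x)
    δ-line (suc i) 2+i≤r = begin
      δ (c ⊕ suc i · x) x       ≡⟨ cong (λ v → δ v x) (y⊕[1+n]·x≡[y⊕n·x]⊕x c i x) ⟩
      δ ((c ⊕ i · x) ⊕ x) x     ≡⟨ δ-step-invariant px (covered⇒interior cov (walk-line i) 1+i≤r)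
                                     (λ w∈A → covered⇒interior cov (walk-⊖ A w∈A (walk-line i)) 2+i≤r) ⟩
      δ (c ⊕ i · x) x           ≡⟨ δ-line i 1+i≤r ⟩
      δ c x                     ∎
      where
      open ≡-Reasoning
      1+i≤r : suc i ≤ r
      1+i≤r = ℕ.<⇒≤ 2+i≤r

    φ-line : ∀ i → i ≤ r → φ (c ⊕ i · x) ≡ φ c ⊕ i · δ c x
    φ-line zero    _     = trans (cong φ (y⊕0·x≡y c x)) (sym (y⊕0·x≡y (φ c) (δ c x)))
    φ-line (suc i) 1+i≤r = begin
      φ (c ⊕ suc i · x)                 ≡⟨ cong φ (y⊕[1+n]·x≡[y⊕n·x]⊕x c i x) ⟩
      φ ((c ⊕ i · x) ⊕ x)               ≡⟨ φ-⊕ (c ⊕ i · x) x ⟩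
      φ (c ⊕ i · x) ⊕ δ (c ⊕ i · x) x   ≡⟨ cong₂ _⊕_ (φ-line i (ℕ.<⇒≤ 1+i≤r)) (δ-line i 1+i≤r) ⟩
      (φ c ⊕ i · δ c x) ⊕ δ c x         ≡⟨ y⊕[1+n]·x≡[y⊕n·x]⊕x (φ c) i (δ c x) ⟨
      φ c ⊕ suc i · δ c x               ∎
      where open ≡-Reasoning

  parallel-lines : ∀ {x a c c' r} → Primary A x → a ∈ A → c' ≡ c ⊕ a → Covers c r → Covers c' r
    → 2 * ‖ A ‖ₐ + 1 ≤ r → δ c x ≡ δ c' x
  parallel-lines {x} {a} {c} {_} {r} px a∈A refl cov cov' n≤r =
    n·a⊕p≡n·b⊕q⇒a≡b s bₙ s' b₀ bound (⊕-cancelˡ (φ c) (n · s ⊕ bₙ) (n · s' ⊕ b₀) ends-agree)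
    where
    module L  = Line px cov
    module L' = Line px cov'
    M n : ℕ
    M = ‖ A ‖ₐ
    n = 2 * M + 1
    s s' bₙ b₀ : G k
    s  = δ c x
    s' = δ (c ⊕ a) x
    bₙ = δ (c ⊕ n · x) a
    b₀ = δ c a

    rung : (c ⊕ n · x) ⊕ a ≡ (c ⊕ a) ⊕ n · x
    rung = [x⊕y]⊕z≡[x⊕z]⊕y c (n · x) a

    ends-agree : φ c ⊕ (n · s ⊕ bₙ) ≡ φ c ⊕ (n · s' ⊕ b₀)
    ends-agree = begin
      φ c ⊕ (n · s ⊕ bₙ)        ≡⟨ ⊕-assoc (φ c) (n · s) bₙ ⟨
      (φ c ⊕ n · s) ⊕ bₙ        ≡⟨ cong (_⊕ bₙ) (L.φ-line n n≤r) ⟨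
      φ (c ⊕ n · x) ⊕ bₙ        ≡⟨ φ-⊕ (c ⊕ n · x) a ⟨
      φ ((c ⊕ n · x) ⊕ a)       ≡⟨ cong φ rung ⟩
      φ ((c ⊕ a) ⊕ n · x)       ≡⟨ L'.φ-line n n≤r ⟩
      φ (c ⊕ a) ⊕ n · s'        ≡⟨ cong (_⊕ n · s') (φ-⊕ c a) ⟩
      (φ c ⊕ b₀) ⊕ n · s'       ≡⟨ [x⊕y]⊕z≡[x⊕z]⊕y (φ c) b₀ (n · s') ⟩
      (φ c ⊕ n · s') ⊕ b₀       ≡⟨ ⊕-assoc (φ c) (n · s') b₀ ⟩
      φ c ⊕ (n · s' ⊕ b₀)       ∎
      where open ≡-Reasoning

    bound : ‖ bₙ ‖ + ‖ b₀ ‖ < n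
    bound = begin-strict
      ‖ bₙ ‖ + ‖ b₀ ‖  ≤⟨ ℕ.+-mono-≤ (‖‖-∈ A bₙ∈A) (‖‖-∈ A b₀∈A) ⟩
      M + M            ≡⟨ cong (λ t → M + t) (ℕ.+-identityʳ M) ⟨
      2 * M            <⟨ ℕ.m<m+n (2 * M) ℕ.z<s ⟩
      n                ∎
      where
      open ℕ.≤-Reasoning
      bₙ∈A : bₙ ∈ A
      bₙ∈A = φ-edge a∈A (L.on-line n≤r) (subst S (sym rung) (L'.on-line n≤r))
      b₀∈A : b₀ ∈ A
      b₀∈A = φ-edge a∈A (covers-centre cov) (covers-centre cov')

module _ {k : ℕ} {A : List (G k)} {r : ℕ} {z : G k} (λg : Subgraph A) {φ : G k → G k}
  (iso : IsIso A r z λg φ) where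

  iso-injective : ∀ {u v} → InC A r z u → InC A r z v → φ u ≡ φ v → u ≡ v
  iso-injective = proj₁ (proj₂ iso) _ _

  iso-edge : ∀ {u a} → a ∈ A → InC A r z u → InC A r z (u ⊕ a) → φ (u ⊕ a) ⊖ φ u ∈ A
  iso-edge {u} {a} a∈A Cu Cu⊕a =
    let b , b∈A , eq = Subgraph.E⊆Adj λg _ _ (proj₁ (proj₂ (proj₂ (proj₂ iso)) _ _ Cu Cu⊕a) (a , a∈A , refl))
    in subst (_∈ A) (sym (trans (cong (_⊖ φ u) eq) ([x⊕y]⊖x≡y (φ u) b))) b∈A

module _ {k : ℕ} {A : List (G k)} {r : ℕ} {z : G k} where

  open Neighbourhoods A (InC A r z) using (Covers)

  origin-covers : Covers 𝟘 r
  origin-covers {u} w m≤r = inj₁ (subst (InBall A r) (x⊖𝟘≡x u) (walk⇒inBall A w m≤r))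

  z-covers : Covers z r
  z-covers w m≤r = inj₂ (walk⇒inBall A w m≤r)

proposition8 : (k : ℕ) → 1 ≤ k → (A : List (G k)) → Unique A → Symmetric A
    → ¬ (𝟘 ∈ A) → Generates A → (D : ℕ) → GoodD A D
    → (r : ℕ) → 2 ≤ r → D ≤ r → 2 * ‖ A ‖ₐ + 1 ≤ r
    → (z : G k) → z ∈ A
    → (λg : Subgraph A) → (φ : G k → G k) → IsIso A r z λg φ
    → ∀ x → Primary A x → φ x ⊖ φ 𝟘 ≡ φ (z ⊕ x) ⊖ φ z
proposition8 _ _ A A-unique _ _ _ _ _ r _ _ n≤r z z∈A λg φ iso x px = begin
  φ x ⊖ φ 𝟘          ≡⟨ cong (λ v → φ v ⊖ φ 𝟘) (⊕-identityˡ x) ⟨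
  δ 𝟘 x              ≡⟨ parallel-lines px z∈A (sym (⊕-identityˡ z))
                          origin-covers z-covers n≤r ⟩
  δ z x              ∎
  where
  open ≡-Reasoning
  open Rigidity A-unique (iso-injective λg iso) (iso-edge λg iso)
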